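{- Let $m,n\ge 2$ and let $f\colon V(K_m)\to V(K_n)$ be any function. Then the diameter of $K_m\otimes_f K_n$ equals $3$.
   Context: For graphs $G$ and $H$ and a function $f\colon V(G)\to V(H)$, the Sierpiński product $G\otimes_f H$ is the graph with vertex set $V(G)\times V(H)$ whose edges are: $(g,h)(g,h')$ for every $g\in V(G)$ and every edge $hh'\in E(H)$; and $(g,f(g'))(g',f(g))$ for every edge $gg'\in E(G)$. $K_m$ denotes the complete graph on $m$ vertices; the diameter of a connected graph is the largest shortest-path distance between two of its vertices. -}

module Defs where

open import Level using (0ℓ)
open import Data.Nat using (ℕ; zero; suc; _≤_; _<_)
open import Data.Fin using (Fin)
open import Data.Product using (Σ; _×_; _,_; ∃)
open import Data.Sum using (_⊎_)
open import Relation.Binary.PropositionalEquality using (_≡_; _≢_)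
open import Relation.Nullary using (¬_)

record Graph : Set₁ where
  field
    V   : Set
    Adj : V → V → Set
open Graph public

data Walk (G : Graph) : V G → V G → ℕ → Set where
  here : ∀ {u} → Walk G u u zero
  step : ∀ {u w v k} → Adj G u w → Walk G w v k → Walk G u v (suc k)

IsDistance : (G : Graph) → V G → V G → ℕ → Set
IsDistance G u v d = Walk G u v d × (∀ k → k < d → ¬ Walk G u v k)

IsDiameter : (G : Graph) → ℕ → Set
IsDiameter G D =
  (∀ u v → Σ ℕ λ d → IsDistance G u v d × d ≤ D)
  × (Σ (V G) λ u → Σ (V G) λ v → IsDistance G u v D)

K : ℕ → Graph
K m = record { V = Fin m ; Adj = λ i j → i ≢ j }

Sierpinski : (G H : Graph) → (V G → V H) → Graph
Sierpinski G H f = record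
  { V = V G × V H
  ; Adj = λ { (g , h) (g' , h') →
        (g ≡ g' × Adj H h h')
      ⊎ (Adj G g g' × h ≡ f g' × h' ≡ f g) }
  }

{-# OPTIONS --safe #-}
-- Any two copies g ≢ g' of K_n are joined by the single bridge (g , f g')(g' , f g), so
-- (g , h) reaches (g' , h') along h → f g', across the bridge, then f g → h': at most 3
-- steps. A walk of length ≤ 2 between different copies either touches an endpoint of
-- that bridge or uses two bridges through a third copy w, which forces f g ≡ f g' and
-- h ≡ f w ≡ h'. Pairs avoiding all of this exist: (0 , f 0) and (g , f g) when
-- f g ≢ f 0, and (0 , b) and (1 , b) with b outside the image of a constant f.
module Submission where

open import Defs
open import Level using (0ℓ)
open import Data.Nat using (ℕ; zero; suc; _+_; _≤_; _<_; z≤n; s≤s)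
open import Data.Nat.Properties
  using (≤-refl; ≤-trans; +-mono-≤; m<n⇒m<1+n; m<1+n⇒m<n∨m≡n; m≤n⇒m<n∨m≡n)
open import Data.Fin using (Fin; punchIn) renaming (zero to fzero; suc to fsuc)
open import Data.Fin.Properties using (any?; punchInᵢ≢i) renaming (_≟_ to _≟ᶠ_)
open import Data.Product using (∃; ∃₂; _×_; _,_)
open import Data.Product.Properties using (≡-dec)
open import Data.Sum using (_⊎_; inj₁; inj₂)
open import Data.Empty using (⊥-elim)
open import Relation.Nullary using (¬_; Dec; yes; no)
open import Relation.Nullary.Decidable using (map′; _×-dec_; _⊎-dec_; ¬?)
open import Relation.Unary using (Pred; Decidable)
open import Relation.Binary.Definitions using (DecidableEquality)
open import Relation.Binary.PropositionalEquality using (_≡_; _≢_; refl; sym; trans)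

Least : (ℕ → Set) → ℕ → Set
Least P d = P d × (∀ k → k < d → ¬ P k)

module _ {P : ℕ → Set} (P? : Decidable P) where

  least-below : ∀ j → (∀ k → k < j → ¬ P k) ⊎ (∃ λ d → Least P d × d < j)
  least-below zero = inj₁ λ _ ()
  least-below (suc j) with least-below j
  ... | inj₂ (d , least , d<j) = inj₂ (d , least , m<n⇒m<1+n d<j)
  ... | inj₁ none<j with P? j
  ...   | yes pj = inj₂ (j , (pj , none<j) , ≤-refl)
  ...   | no ¬pj = inj₁ none≤j
    where
    none≤j : ∀ k → k < suc j → ¬ P k
    none≤j k k<1+j with m<1+n⇒m<n∨m≡n k<1+j
    ... | inj₁ k<j  = none<j k k<j
    ... | inj₂ refl = ¬pj

  least-≤-witness : ∀ {j} → P j → ∃ λ d → Least P d × d ≤ j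
  least-≤-witness {j} pj with least-below (suc j)
  ... | inj₁ none                   = ⊥-elim (none j ≤-refl pj)
  ... | inj₂ (d , least , s≤s d≤j) = d , least , d≤j

Least-of-≤ : ∀ {P : ℕ → Set} {d j} → (∀ k → k < d → ¬ P k) → P j → j ≤ d → Least P d
Least-of-≤ none<d pj j≤d with m≤n⇒m<n∨m≡n j≤d
... | inj₁ j<d  = ⊥-elim (none<d _ j<d pj)
... | inj₂ refl = pj , none<d

Searchable : Set → Set₁
Searchable A = {P : Pred A 0ℓ} → Decidable P → Dec (∃ P)

searchable-× : ∀ {A B} → Searchable A → Searchable B → Searchable (A × B)
searchable-× searchA searchB P? =
  map′ (λ { (a , b , p) → (a , b) , p }) (λ { ((a , b) , p) → a , b , p })
       (searchA λ a → searchB λ b → P? (a , b))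

_++ʷ_ : ∀ {G u w v i j} → Walk G u w i → Walk G w v j → Walk G u v (i + j)
here     ++ʷ q = q
step a p ++ʷ q = step a (p ++ʷ q)

module _ (G : Graph) (_≟_ : DecidableEquality (V G)) (adj? : ∀ u v → Dec (Adj G u v))
         (search : Searchable (V G)) where

  walk? : ∀ k u v → Dec (Walk G u v k)
  walk? zero    u v = map′ (λ { refl → here }) (λ { here → refl }) (u ≟ v)
  walk? (suc k) u v =
    map′ (λ { (w , a , p) → step a p }) (λ { (step a p) → _ , a , p })
         (search λ w → adj? u w ×-dec walk? k w v)

  distance-≤ : ∀ {u v j} → Walk G u v j → ∃ λ d → IsDistance G u v d × d ≤ j
  distance-≤ {u} {v} = least-≤-witness (λ k → walk? k u v)

module SierpinskiProduct (G H : Graph) (f : V G → V H) where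

  private
    S : Graph
    S = Sierpinski G H f

  sierpinski-adj? : DecidableEquality (V G) → DecidableEquality (V H) →
    (∀ g g' → Dec (Adj G g g')) → (∀ h h' → Dec (Adj H h h')) →
    ∀ u v → Dec (Adj S u v)
  sierpinski-adj? _≟G_ _≟H_ adjG? adjH? (g , h) (g' , h') =
    (g ≟G g' ×-dec adjH? h h') ⊎-dec (adjG? g g' ×-dec h ≟H f g' ×-dec h' ≟H f g)

  fibre-walk : ∀ {g h h' k} → Walk H h h' k → Walk S (g , h) (g , h') k
  fibre-walk here       = here
  fibre-walk (step a p) = step (inj₁ (refl , a)) (fibre-walk p)

  bridge : ∀ {g g'} → Adj G g g' → Adj S (g , f g') (g' , f g)
  bridge a = inj₂ (a , refl , refl)

  FarApart : V S → V S → Set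
  FarApart (g , h) (g' , h') =
    g ≢ g' × h ≢ f g' × h' ≢ f g × (∀ w → f w ≡ h → f w ≡ h' → f g ≢ f g')

  farApart⇒no-walk<3 : ∀ {u v} → FarApart u v → ∀ k → k < 3 → ¬ Walk S u v k
  farApart⇒no-walk<3 (g≢g' , _ , _ , _) 0 _ here = g≢g' refl
  farApart⇒no-walk<3 (g≢g' , _ , _ , _) 1 _ (step (inj₁ (g≡g' , _)) here) = g≢g' g≡g'
  farApart⇒no-walk<3 (_ , h≢fg' , _ , _) 1 _ (step (inj₂ (_ , h≡fg' , _)) here) = h≢fg' h≡fg'
  farApart⇒no-walk<3 (g≢g' , _ , _ , _) 2 _
    (step (inj₁ (refl , _)) (step (inj₁ (g≡g' , _)) here)) = g≢g' g≡g'
  farApart⇒no-walk<3 (_ , _ , h'≢fg , _) 2 _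
    (step (inj₁ (refl , _)) (step (inj₂ (_ , _ , h'≡fg)) here)) = h'≢fg h'≡fg
  farApart⇒no-walk<3 (_ , h≢fg' , _ , _) 2 _
    (step (inj₂ (_ , h≡fg' , _)) (step (inj₁ (refl , _)) here)) = h≢fg' h≡fg'
  farApart⇒no-walk<3 (_ , _ , _ , no-detour) 2 _
    (step {w = w , _} (inj₂ (_ , h≡fw , fg≡x)) (step (inj₂ (_ , x≡fg' , h'≡fw)) here)) =
    no-detour w (sym h≡fw) (sym h'≡fw) (trans (sym fg≡x) x≡fg')
  farApart⇒no-walk<3 _ (suc (suc (suc _))) (s≤s (s≤s (s≤s ())))

K-walk≤1 : ∀ {n} (i j : Fin n) → ∃ λ k → k ≤ 1 × Walk (K n) i j k
K-walk≤1 i j with i ≟ᶠ j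
... | yes refl = 0 , z≤n , here
... | no i≢j   = 1 , ≤-refl , step i≢j here

module _ {m n : ℕ} (f : Fin m → Fin n) where

  open SierpinskiProduct (K m) (K n) f

  private
    S : Graph
    S = Sierpinski (K m) (K n) f

    adj? : ∀ u v → Dec (Adj S u v)
    adj? = sierpinski-adj? _≟ᶠ_ _≟ᶠ_ (λ g g' → ¬? (g ≟ᶠ g')) (λ h h' → ¬? (h ≟ᶠ h'))

  sierpinski-K-walk≤3 : ∀ u v → ∃ λ k → k ≤ 3 × Walk S u v k
  sierpinski-K-walk≤3 (g , h) (g' , h') with g ≟ᶠ g'
  ... | yes refl with K-walk≤1 h h'
  ...   | k , k≤1 , p = k , ≤-trans k≤1 (s≤s z≤n) , fibre-walk p
  sierpinski-K-walk≤3 (g , h) (g' , h') | no g≢g'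
    with K-walk≤1 h (f g') | K-walk≤1 (f g) h'
  ... | i , i≤1 , p | j , j≤1 , q =
    i + suc j , +-mono-≤ i≤1 (s≤s j≤1) ,
    fibre-walk p ++ʷ step (bridge g≢g') (fibre-walk q)

  sierpinski-K-distance≤3 : ∀ u v → ∃ λ d → IsDistance S u v d × d ≤ 3
  sierpinski-K-distance≤3 u v with sierpinski-K-walk≤3 u v
  ... | k , k≤3 , p with distance-≤ S (≡-dec _≟ᶠ_ _≟ᶠ_) adj? (searchable-× any? any?) p
  ...   | d , dist , d≤k = d , dist , ≤-trans d≤k k≤3

  farApart⇒distance3 : ∀ {u v} → FarApart u v → IsDistance S u v 3
  farApart⇒distance3 {u} {v} far with sierpinski-K-walk≤3 u v
  ... | k , k≤3 , p = Least-of-≤ (farApart⇒no-walk<3 far) p k≤3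

farApart-exists : ∀ {m n} (f : Fin (suc (suc m)) → Fin (suc (suc n))) →
  ∃₂ (SierpinskiProduct.FarApart (K (suc (suc m))) (K (suc (suc n))) f)
farApart-exists {n = n} f with any? (λ g → ¬? (f g ≟ᶠ f fzero))
... | yes (g , fg≢f0) =
  (fzero , f fzero) , (g , f g) ,
  (λ { refl → fg≢f0 refl }) , (λ e → fg≢f0 (sym e)) , fg≢f0 , (λ _ _ _ e → fg≢f0 (sym e))
... | no f-constant =
  (fzero , b) , (fsuc fzero , b) , (λ ()) , b≢f _ , b≢f _ , (λ w fw≡b _ _ → b≢f w (sym fw≡b))
  where
  b : Fin (suc (suc n))
  b = punchIn (f fzero) fzero

  b≢f : ∀ g → b ≢ f g
  b≢f g b≡fg with f g ≟ᶠ f fzero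
  ... | yes fg≡f0 = punchInᵢ≢i (f fzero) fzero (trans b≡fg fg≡f0)
  ... | no fg≢f0  = f-constant (g , fg≢f0)

lemma3p1 : (m n : ℕ) → 2 ≤ m → 2 ≤ n → (f : Fin m → Fin n) →
    IsDiameter (Sierpinski (K m) (K n) f) 3
lemma3p1 (suc (suc m)) (suc (suc n)) (s≤s (s≤s _)) (s≤s (s≤s _)) f
  with farApart-exists f
... | u , v , far = sierpinski-K-distance≤3 f , u , v , farApart⇒distance3 f far
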